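{- Let $n\ge 2$ be an integer. Then there is a one-to-one correspondence between the set of aperiodic palindromes of $n$ and the set of connected circulant graphs of order $n$, i.e. the set $\{\Omega\subseteq\mathbb{Z}_n \mid 0\in\Omega,\ \Omega=-\Omega,\ \langle\Omega\rangle=\mathbb{Z}_n\}$.
   Context: A composition of $n$ is a finite ordered word $\sigma_1\cdots\sigma_m$ of positive integers summing to $n$; it is a palindrome if it equals its reversal $\sigma_m\cdots\sigma_1$. A composition with $m$ parts is aperiodic if it is not the concatenation of $r\ge2$ copies of a shorter word (its period is $m$). For $S\subseteq\mathbb{Z}_n$ with $S=-S$, the circulant graph $G(n,S)$ has vertex set $\{0,\ldots,n-1\}$ and edges $\{i,j\}$ with $i\ne j$, $j-i\in S\pmod n$; circulant graphs of order $n$ are identified with connection sets $\Omega\subseteq\mathbb{Z}_n$ with $0\in\Omega=-\Omega$, and $G(n,\Omega)$ is connected iff $\langle\Omega\rangle=\mathbb{Z}_n$. -}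

module Defs where

open import Level using (0ℓ)
open import Data.Nat using (ℕ; _+_; _*_; _≤_; _<_)
open import Data.Nat.Divisibility using (_∣_)
open import Data.Nat.ListAction using (sum)
open import Data.List using (List; reverse; concat; replicate; length)
open import Data.List.Relation.Unary.All using (All)
open import Data.Fin using (Fin; toℕ)
open import Data.Fin.Subset using (Subset; _∈_)
open import Data.Product using (Σ; ∃; ∃-syntax; _×_; proj₁)
open import Relation.Nullary using (¬_)
open import Relation.Binary.Bundles using (Setoid)
open import Relation.Binary.PropositionalEquality using (_≡_; setoid)
import Relation.Binary.Construct.On as On

IsComposition : ℕ → List ℕ → Set
IsComposition n w = All (λ x → 1 ≤ x) w × sum w ≡ n

IsPalindrome : List ℕ → Set
IsPalindrome w = reverse w ≡ w

IsAperiodic : List ℕ → Set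
IsAperiodic w = ¬ (∃[ r ] ∃[ u ] (2 ≤ r × w ≡ concat (replicate r u)))

IsAperiodicPalindrome : ℕ → List ℕ → Set
IsAperiodicPalindrome n w = IsComposition n w × IsPalindrome w × IsAperiodic w

AperiodicPalindrome : ℕ → Set
AperiodicPalindrome n = Σ (List ℕ) (IsAperiodicPalindrome n)

AperiodicPalindromeSetoid : ℕ → Setoid 0ℓ 0ℓ
AperiodicPalindromeSetoid n =
  On.setoid {B = AperiodicPalindrome n} (setoid (List ℕ)) proj₁

data Generated {n : ℕ} (Ω : Subset n) : Fin n → Set where
  gen  : ∀ {x} → x ∈ Ω → Generated Ω x
  zero : ∀ {x} → toℕ x ≡ 0 → Generated Ω x
  add  : ∀ {x y z} → Generated Ω y → Generated Ω z →
         (∃[ k ] toℕ y + toℕ z ≡ toℕ x + k * n) → Generated Ω x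
  neg  : ∀ {x y} → Generated Ω y → n ∣ toℕ x + toℕ y → Generated Ω x

IsConnectedCirculant : (n : ℕ) → Subset n → Set
IsConnectedCirculant n Ω =
  (∀ (z : Fin n) → toℕ z ≡ 0 → z ∈ Ω) ×
  (∀ (x y : Fin n) → n ∣ toℕ x + toℕ y → x ∈ Ω → y ∈ Ω) ×
  (∀ (x : Fin n) → Generated Ω x)

ConnectedCirculant : ℕ → Set
ConnectedCirculant n = Σ (Subset n) (IsConnectedCirculant n)

ConnectedCirculantSetoid : ℕ → Setoid 0ℓ 0ℓ
ConnectedCirculantSetoid n =
  On.setoid {B = ConnectedCirculant n} (setoid (Subset n)) proj₁

-- A composition of n is encoded by its set of partial sums, a subset of ℤ_n containing 0, i.e. a
-- boolean word of length n starting with true.  Palindromes then become the connection sets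
-- (0 ∈ Ω = −Ω) and aperiodic compositions the sets fixed by no proper rotation.  Every connection
-- set of ℤ_n is the preimage, under ℤ_n → ℤ_d, of an aperiodic connection set of ℤ_d for exactly
-- one d ∣ n (its minimal period), and it is also the image, under ℤ_d ↪ ℤ_n, x ↦ (n/d)x, of a
-- connected connection set of ℤ_d for exactly one d ∣ n (namely n/d = gcd(n, Ω)).  Writing A(d)
-- and C(d) for the numbers of aperiodic and of connected connection sets of ℤ_d, counting both ways
-- gives Σ_{d∣n} A(d) = Σ_{d∣n} C(d) for every n ≥ 1, hence A(n) = C(n) by strong induction, and
-- finite sets with equally many elements are in bijection.
module Submission where

open import Defs

open import Data.Bool using (Bool; true; false; T; _∧_; if_then_else_; _≟_)
open import Data.Bool.Properties using (T-irrelevant; T-∧; T-≡; not-¬; ¬-not; ⇔→≡)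
open import Data.Empty using (⊥-elim)
open import Data.Fin using (Fin; zero; suc; toℕ; fromℕ<)
open import Data.Fin.Permutation using (↔⇒≡)
open import Data.Fin.Properties using (+↔⊎; all?; toℕ<n; toℕ-fromℕ<; toℕ-injective)
open import Data.Fin.Subset using (Subset; _∈_)
open import Data.List using (List; []; _∷_; _++_; _∷ʳ_; [_]; length; reverse; replicate; concat; take)
open import Data.List.Properties
  using (length-++; length-replicate; length-reverse; length-take; unfold-reverse; reverse-++; ++-assoc; ++-identityʳ; ∷ʳ-injectiveˡ)
open import Data.List.Relation.Unary.All using (All; []; _∷_)
open import Data.List.Relation.Unary.All.Properties using (∷ʳ⁺; concat⁺; replicate⁺)
open import Data.Nat
  using (ℕ; zero; suc; _+_; _*_; _∸_; _%_; _/_; _≤_; _<_; _≡ᵇ_; _<ᵇ_; _<?_; z≤n; s≤s; s≤s⁻¹; z<s;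
         NonZero; >-nonZero; >-nonZero⁻¹; ≢-nonZero; ≢-nonZero⁻¹)
  renaming (_≟_ to _≟ℕ_)
open import Data.Nat.Divisibility
  using (_∣_; divides; _∣?_; ∣-refl; ∣-trans; ∣-antisym; ∣⇒≤; _∣0; ∣1⇒≡1; n∣m*n; ∣n⇒∣m*n; *-monoʳ-∣;
         ∣m+n∣m⇒∣n; ∣m∣n⇒∣m+n; m%n≡0⇒n∣m; n∣m⇒m%n≡0; quotient; quotient≢0; quotient-∣; m∣n⇒n≡quotient*m)
open import Data.Nat.DivMod
  using (m≡m%n+[m/n]*n; m%n<n; m%n≤n; m<n⇒m%n≡m; [m+n]%n≡m%n; m*n/n≡m; n%n≡0; %-distribˡ-+; %-remove-+ʳ;
         m∣n⇒o%n%m≡o%m)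
open import Data.Nat.GCD using (gcd; gcd[m,n]∣m; gcd[m,n]∣n; gcd-greatest; c*gcd[m,n]≡gcd[cm,cn]; gcd-GCD; module Bézout)
open import Data.Nat.Induction using (<-rec)
open import Data.Nat.ListAction using (sum)
open import Data.Nat.Properties
  using (+-assoc; +-comm; +-identityʳ; +-cancelˡ-≡; +-cancelˡ-<; +-mono-<; +-monoʳ-≤; +-∸-comm; +-∸-assoc;
         *-comm; *-identityˡ; *-identityʳ; *-zeroʳ; *-distribʳ-+; *-distribʳ-∸; *-cancelˡ-≡; *-cancelʳ-≡;
         *-cancelʳ-<; *-monoˡ-<; m*n≢0; m*n≢0⇒n≢0; ∸-+-assoc; ∸-monoˡ-≤; ∸-monoʳ-<; m∸n+n≡m; m+n∸n≡m; m+n∸m≡n;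
         m+[n∸m]≡n; n∸n≡0; m+n≡0⇒m≡0; m+n≡0⇒n≡0; ≤-refl; <-trans; <-≤-trans; ≤-<-trans; <-irrefl; <⇒≤; ≮⇒≥;
         <-cmp; m≤m+n; m≤n+m; m≤n⇒m≤1+n; m<n⇒m<1+n; n<1+n; m≤n⇒m<n∨m≡n; m≤n⇒m⊓n≡m; suc-injective;
         <⇒<ᵇ; ≡ᵇ⇒≡; ≡⇒≡ᵇ; +-commutativeSemigroup; module ≤-Reasoning)
open import Algebra.Properties.CommutativeSemigroup +-commutativeSemigroup using (interchange; xy∙z≈xz∙y)
open import Data.Product using (Σ; _,_; proj₁; proj₂; _×_)
open import Data.Product.Function.NonDependent.Propositional using (_×-⇔_)
open import Data.Sum using (inj₁; inj₂; _⊎_; [_,_]′)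
open import Data.Sum.Function.Propositional using (_⊎-↔_)
open import Data.Vec using (Vec; []; _∷_; toList; fromList; cast; lookup)
open import Data.Vec.Properties using ([]=⇒lookup; lookup⇒[]=; length-toList; toList-cast; toList∘fromList; fromList∘toList)
open import Function using (it; _∘_; _↔_; _⇔_; mk↔ₛ′; mk⇔; Equivalence; Inverse; Bijection)
import Function.Construct.Composition as Composition
import Function.Construct.Symmetry as Symmetry
open import Function.Properties.Equivalence using () renaming (trans to ⇔-trans)
open import Function.Properties.Inverse using (↔-sym; ↔-trans; Inverse⇒Bijection)
open import Relation.Binary.Definitions using (tri<; tri≈; tri>)
open import Relation.Binary.PropositionalEquality hiding ([_])
import Relation.Binary.Construct.On as On
open import Relation.Nullary using (¬_; Dec; yes; no; does)
open import Relation.Nullary.Decidable using (isYes; toWitness; fromWitness; map′; _×-dec_; ¬?; _→-dec_)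

-- Counting boolean vectors

indicator : Bool → ℕ
indicator true  = 1
indicator false = 0

∑ᵛ : ∀ n → (Vec Bool n → ℕ) → ℕ
∑ᵛ zero    w = w []
∑ᵛ (suc n) w = ∑ᵛ n (w ∘ (true ∷_)) + ∑ᵛ n (w ∘ (false ∷_))

count : ∀ n → (Vec Bool n → Bool) → ℕ
count n P = ∑ᵛ n (indicator ∘ P)

Solutions : ∀ n → (Vec Bool n → Bool) → Set
Solutions n P = Σ (Vec Bool n) (T ∘ P)

Solutions-≡ : ∀ {n P} {x y : Solutions n P} → proj₁ x ≡ proj₁ y → x ≡ y
Solutions-≡ {x = v , p} {.v , q} refl = cong (v ,_) (T-irrelevant p q)

Fin-indicator↔T : ∀ b → Fin (indicator b) ↔ T b
Fin-indicator↔T true  = mk↔ₛ′ _ (λ _ → zero) (λ _ → refl) (λ { zero → refl })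
Fin-indicator↔T false = mk↔ₛ′ (λ ()) (λ ()) (λ ()) (λ ())

Solutions-[]↔ : ∀ P → Solutions 0 P ↔ T (P [])
Solutions-[]↔ P = mk↔ₛ′ (λ { ([] , p) → p }) ([] ,_) (λ _ → refl) (λ { ([] , _) → refl })

Solutions-∷↔ : ∀ n P →
  Solutions (suc n) P ↔ (Solutions n (P ∘ (true ∷_)) ⊎ Solutions n (P ∘ (false ∷_)))
Solutions-∷↔ n P = mk↔ₛ′ split merge split-merge merge-split
  where
  split : Solutions (suc n) P → _
  split (true  ∷ v , p) = inj₁ (v , p)
  split (false ∷ v , p) = inj₂ (v , p)
  merge : _ → Solutions (suc n) P
  merge (inj₁ (v , p)) = true  ∷ v , p
  merge (inj₂ (v , p)) = false ∷ v , p
  split-merge : ∀ x → split (merge x) ≡ x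
  split-merge (inj₁ _) = refl
  split-merge (inj₂ _) = refl
  merge-split : ∀ x → merge (split x) ≡ x
  merge-split (true  ∷ _ , _) = refl
  merge-split (false ∷ _ , _) = refl

enumerate : ∀ n P → Fin (count n P) ↔ Solutions n P
enumerate zero    P = ↔-trans (Fin-indicator↔T (P [])) (↔-sym (Solutions-[]↔ P))
enumerate (suc n) P =
  ↔-trans +↔⊎ (↔-trans (enumerate n _ ⊎-↔ enumerate n _) (↔-sym (Solutions-∷↔ n P)))

module _ {n m} {P : Vec Bool n → Bool} {Q : Vec Bool m → Bool} where

  ↔⇒count≡ : Solutions n P ↔ Solutions m Q → count n P ≡ count m Q
  ↔⇒count≡ i = ↔⇒≡ (↔-trans (enumerate n P) (↔-trans i (↔-sym (enumerate m Q))))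

  count≡⇒↔ : count n P ≡ count m Q → Solutions n P ↔ Solutions m Q
  count≡⇒↔ e = ↔-trans (↔-sym (enumerate n P)) (subst (λ c → Fin c ↔ _) (sym e) (enumerate m Q))

  mkSolutions↔ : (f : Vec Bool n → Vec Bool m) (g : Vec Bool m → Vec Bool n) →
    (∀ v → T (P v) → T (Q (f v))) → (∀ v → T (Q v) → T (P (g v))) →
    (∀ v → T (Q v) → f (g v) ≡ v) → (∀ v → T (P v) → g (f v) ≡ v) →
    Solutions n P ↔ Solutions m Q
  mkSolutions↔ f g P⇒Q Q⇒P fg gf = mk↔ₛ′
    (λ (v , p) → f v , P⇒Q v p) (λ (v , q) → g v , Q⇒P v q)
    (λ (v , q) → Solutions-≡ (fg v q)) (λ (v , p) → Solutions-≡ (gf v p))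

count-none : ∀ n {P} → (∀ v → ¬ T (P v)) → count n P ≡ 0
count-none n {P} none = ↔⇒≡ (↔-trans (enumerate n P)
  (mk↔ₛ′ (λ (v , p) → ⊥-elim (none v p)) (λ ()) (λ ()) (λ (v , p) → ⊥-elim (none v p))))

∧-≡ᵇ⇔ : ∀ {b m d} → T (b ∧ (m ≡ᵇ d)) ⇔ (T b × m ≡ d)
∧-≡ᵇ⇔ {b} {m} {d} = mk⇔
  (λ t → let (tb , e) = Equivalence.to T-∧ t in tb , ≡ᵇ⇒≡ m d e)
  (λ (tb , e) → Equivalence.from T-∧ (tb , ≡⇒≡ᵇ m d e))

∑ᵛ-cong : ∀ n {w w′ : Vec Bool n → ℕ} → (∀ v → w v ≡ w′ v) → ∑ᵛ n w ≡ ∑ᵛ n w′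
∑ᵛ-cong zero    e = e []
∑ᵛ-cong (suc n) e = cong₂ _+_ (∑ᵛ-cong n (e ∘ _)) (∑ᵛ-cong n (e ∘ _))

∑ᵛ-zero : ∀ n → ∑ᵛ n (λ _ → 0) ≡ 0
∑ᵛ-zero zero    = refl
∑ᵛ-zero (suc n) = cong₂ _+_ (∑ᵛ-zero n) (∑ᵛ-zero n)

∑ᵛ-+ : ∀ n (w w′ : Vec Bool n → ℕ) → ∑ᵛ n (λ v → w v + w′ v) ≡ ∑ᵛ n w + ∑ᵛ n w′
∑ᵛ-+ zero    w w′ = refl
∑ᵛ-+ (suc n) w w′ = trans
  (cong₂ _+_ (∑ᵛ-+ n (w ∘ (true ∷_)) (w′ ∘ (true ∷_))) (∑ᵛ-+ n (w ∘ (false ∷_)) (w′ ∘ (false ∷_))))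
  (interchange (∑ᵛ n (w ∘ (true ∷_))) _ _ _)

∑< : ℕ → (ℕ → ℕ) → ℕ
∑< zero    f = 0
∑< (suc m) f = ∑< m f + f m

∑<-cong : ∀ m {f g : ℕ → ℕ} → (∀ k → k < m → f k ≡ g k) → ∑< m f ≡ ∑< m g
∑<-cong zero    e = refl
∑<-cong (suc m) e = cong₂ _+_ (∑<-cong m (λ k k<m → e k (m<n⇒m<1+n k<m))) (e m (n<1+n m))

∑<-zero : ∀ m → ∑< m (λ _ → 0) ≡ 0
∑<-zero zero    = refl
∑<-zero (suc m) = trans (+-identityʳ _) (∑<-zero m)

∑ᵛ-∑< : ∀ n m (w : ℕ → Vec Bool n → ℕ) →
  ∑ᵛ n (λ v → ∑< m (λ k → w k v)) ≡ ∑< m (λ k → ∑ᵛ n (w k))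
∑ᵛ-∑< n zero    w = ∑ᵛ-zero n
∑ᵛ-∑< n (suc m) w =
  trans (∑ᵛ-+ n (λ v → ∑< m (λ k → w k v)) (w m)) (cong (_+ ∑ᵛ n (w m)) (∑ᵛ-∑< n m w))

indicator-<ᵇ-suc : ∀ ℓ m → indicator (ℓ <ᵇ m) + indicator (ℓ ≡ᵇ m) ≡ indicator (ℓ <ᵇ suc m)
indicator-<ᵇ-suc zero    zero    = refl
indicator-<ᵇ-suc zero    (suc m) = refl
indicator-<ᵇ-suc (suc ℓ) zero    = refl
indicator-<ᵇ-suc (suc ℓ) (suc m) = indicator-<ᵇ-suc ℓ m

∑<-indicator-≡ᵇ : ∀ ℓ m → ∑< m (λ k → indicator (ℓ ≡ᵇ k)) ≡ indicator (ℓ <ᵇ m)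
∑<-indicator-≡ᵇ ℓ zero    = refl
∑<-indicator-≡ᵇ ℓ (suc m) = trans (cong (_+ indicator (ℓ ≡ᵇ m)) (∑<-indicator-≡ᵇ ℓ m)) (indicator-<ᵇ-suc ℓ m)

count-by-label : ∀ n m P (label : Vec Bool n → ℕ) → (∀ v → label v < m) →
  count n P ≡ ∑< m (λ k → count n (λ v → P v ∧ (label v ≡ᵇ k)))
count-by-label n m P label bound =
  trans (∑ᵛ-cong n split) (∑ᵛ-∑< n m (λ k v → indicator (P v ∧ (label v ≡ᵇ k))))
  where
  split : ∀ v → indicator (P v) ≡ ∑< m (λ k → indicator (P v ∧ (label v ≡ᵇ k)))
  split v with P v
  ... | true  = sym (trans (∑<-indicator-≡ᵇ (label v) m)
                           (cong indicator (Equivalence.to T-≡ (<⇒<ᵇ (bound v)))))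
  ... | false = sym (∑<-zero m)

-- For n ≠ 0 this is the sum over the divisors of n, because 0 ∤ n.
∑∣ : ℕ → (ℕ → ℕ) → ℕ
∑∣ n f = ∑< (suc n) (λ d → if does (d ∣? n) then f d else 0)

count-by-divisor-label : ∀ n P (label : Vec Bool n → ℕ) (f : ℕ → ℕ) →
  (∀ v → label v ≤ n) → (∀ v → T (P v) → label v ∣ n) →
  (∀ d → d ∣ n → count n (λ v → P v ∧ (label v ≡ᵇ d)) ≡ f d) →
  count n P ≡ ∑∣ n f
count-by-divisor-label n P label f bound label∣n class =
  trans (count-by-label n (suc n) P label (s≤s ∘ bound)) (∑<-cong (suc n) (λ d _ → term d))
  where
  term : ∀ d → count n (λ v → P v ∧ (label v ≡ᵇ d)) ≡ (if does (d ∣? n) then f d else 0)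
  term d with d ∣? n
  ... | yes d∣n = class d d∣n
  ... | no ¬d∣n = count-none n λ v t →
    let (p , e) = Equivalence.to T-∧ t in ¬d∣n (subst (_∣ n) (≡ᵇ⇒≡ (label v) d e) (label∣n v p))

∑∣-cancel : ∀ n {f g : ℕ → ℕ} → (∀ d → d ∣ n → d < n → f d ≡ g d) → ∑∣ n f ≡ ∑∣ n g → f n ≡ g n
∑∣-cancel n {f} {g} below total with n ∣? n
... | yes _   = +-cancelˡ-≡ _ _ _ (trans (cong (_+ f n) (∑<-cong n initial)) total)
  where
  initial : ∀ d → d < n → (if does (d ∣? n) then g d else 0) ≡ (if does (d ∣? n) then f d else 0)
  initial d d<n with d ∣? n
  ... | yes d∣n = sym (below d d∣n d<n)
  ... | no  _   = refl
... | no ¬n∣n = ⊥-elim (¬n∣n ∣-refl)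

-- Periods

all<? : ∀ n {P : ℕ → Set} → (∀ i → Dec (P i)) → Dec (∀ i → i < n → P i)
all<? n {P} P? = map′ (λ h i i<n → subst P (toℕ-fromℕ< i<n) (h (fromℕ< i<n)))
                      (λ h i → h (toℕ i) (toℕ<n i))
                      (all? (P? ∘ toℕ))

least : ∀ {P : ℕ → Set} → (∀ i → Dec (P i)) → ∀ {q} → P q →
        Σ ℕ λ p → p ≤ q × P p × (∀ {r} → r < p → ¬ P r)
least {P} P? {q} Pq with search q
  where
  search : ∀ j → (Σ ℕ λ p → p ≤ j × P p × (∀ {r} → r < p → ¬ P r)) ⊎ (∀ {r} → r ≤ j → ¬ P r)
  search zero with P? 0
  ... | yes P0 = inj₁ (0 , z≤n , P0 , λ ())
  ... | no ¬P0 = inj₂ λ { z≤n → ¬P0 }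
  search (suc j) with search j | P? (suc j)
  ... | inj₁ (p , p≤j , Pp , below) | _ = inj₁ (p , m≤n⇒m≤1+n p≤j , Pp , below)
  ... | inj₂ none | yes Psj = inj₁ (suc j , ≤-refl , Psj , none ∘ s≤s⁻¹)
  ... | inj₂ none | no ¬Psj = inj₂ λ r≤sj → [ none ∘ s≤s⁻¹ , (λ { refl → ¬Psj }) ]′ (m≤n⇒m<n∨m≡n r≤sj)
... | inj₁ witness = witness
... | inj₂ none    = ⊥-elim (none ≤-refl Pq)

Period : (ℕ → Bool) → ℕ → Set
Period f q = ∀ i → f (i + q) ≡ f i

Aperiodic : ℕ → (ℕ → Bool) → Set
Aperiodic n f = ∀ {q} → 0 < q → q < n → ¬ Period f q

IsMinimalPeriod : (ℕ → Bool) → ℕ → Set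
IsMinimalPeriod f p = 0 < p × Period f p × Aperiodic p f

module _ {f : ℕ → Bool} where

  Period-* : ∀ {q} → Period f q → ∀ k → Period f (k * q)
  Period-* per zero    i = cong f (+-identityʳ i)
  Period-* {q} per (suc k) i = begin
    f (i + (q + k * q)) ≡⟨ cong f (sym (+-assoc i q (k * q))) ⟩
    f (i + q + k * q)   ≡⟨ Period-* per k (i + q) ⟩
    f (i + q)           ≡⟨ per i ⟩
    f i                 ∎
    where open ≡-Reasoning

  Period-∣ : ∀ {p N} → Period f p → p ∣ N → Period f N
  Period-∣ per (divides k refl) = Period-* per k

  module _ {N} .{{_ : NonZero N}} (perN : Period f N) where

    Period-% : ∀ i → f (i % N) ≡ f i
    Period-% i = trans (sym (Period-* perN (i / N) (i % N))) (cong f (sym (m≡m%n+[m/n]*n i N)))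

    Period-bounded : ∀ {q} → (∀ i → i < N → f (i + q) ≡ f i) → Period f q
    Period-bounded {q} per i = begin
      f (i + q)                   ≡⟨ cong (λ j → f (j + q)) (m≡m%n+[m/n]*n i N) ⟩
      f (i % N + i / N * N + q)   ≡⟨ cong f (xy∙z≈xz∙y (i % N) _ q) ⟩
      f (i % N + q + i / N * N)   ≡⟨ Period-* perN (i / N) (i % N + q) ⟩
      f (i % N + q)               ≡⟨ per (i % N) (m%n<n i N) ⟩
      f (i % N)                   ≡⟨ Period-% i ⟩
      f i                         ∎
      where open ≡-Reasoning

    Period? : ∀ q → Dec (Period f q)
    Period? q = map′ Period-bounded (λ per i _ → per i) (all<? N (λ i → f (i + q) ≟ f i))

    Aperiodic? : ∀ n → Dec (Aperiodic n f)
    Aperiodic? n = map′ (λ h 0<q q<n → h _ q<n 0<q) (λ h q q<n 0<q → h 0<q q<n)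
      (all<? n (λ q → 0 <? q →-dec ¬? (Period? q)))

    Period-remainder : ∀ {p} .{{_ : NonZero p}} → Period f p → Period f (N % p)
    Period-remainder {p} perp i = begin
      f (i + N % p)               ≡⟨ Period-* perp (N / p) (i + N % p) ⟨
      f (i + N % p + N / p * p)   ≡⟨ cong f (+-assoc i (N % p) _) ⟩
      f (i + (N % p + N / p * p)) ≡⟨ cong (λ j → f (i + j)) (m≡m%n+[m/n]*n N p) ⟨
      f (i + N)                   ≡⟨ perN i ⟩
      f i                         ∎
      where open ≡-Reasoning

    IsMinimalPeriod-∣ : ∀ {p} → IsMinimalPeriod f p → p ∣ N
    IsMinimalPeriod-∣ {p@(suc _)} (_ , perp , aper) with N % p in eq
    ... | zero  = m%n≡0⇒n∣m N p eq
    ... | suc r = ⊥-elim (aper z<s (subst (_< p) eq (m%n<n N p)) (subst (Period f) eq (Period-remainder perp)))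

    minimalPeriod : Σ ℕ λ p → p ≤ N × IsMinimalPeriod f p
    minimalPeriod with least (λ q → 0 <? q ×-dec Period? q) (>-nonZero⁻¹ N , perN)
    ... | p , p≤N , (0<p , perp) , below = p , p≤N , 0<p , perp , λ 0<q q<p per → below q<p (0<q , per)

  IsMinimalPeriod-unique : ∀ {p p′} → IsMinimalPeriod f p → IsMinimalPeriod f p′ → p ≡ p′
  IsMinimalPeriod-unique {p} {p′} (0<p , perp , aperp) (0<p′ , perp′ , aperp′) with <-cmp p p′
  ... | tri< p<p′ _ _ = ⊥-elim (aperp′ 0<p p<p′ perp)
  ... | tri≈ _ p≡p′ _ = p≡p′
  ... | tri> _ _ p′<p = ⊥-elim (aperp 0<p′ p′<p perp′)

IsMinimalPeriod-≤ : ∀ {f p q} → IsMinimalPeriod f p → 0 < q → Period f q → p ≤ q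
IsMinimalPeriod-≤ (_ , _ , aper) 0<q per = ≮⇒≥ (λ q<p → aper 0<q q<p per)

Period-resp : ∀ {f g q} → f ≗ g → Period f q → Period g q
Period-resp f≗g per i = trans (sym (f≗g _)) (trans (per i) (f≗g i))

Aperiodic-resp : ∀ {f g n} → f ≗ g → Aperiodic n f → Aperiodic n g
Aperiodic-resp f≗g aper 0<q q<n per = aper 0<q q<n (Period-resp (sym ∘ f≗g) per)

-- Words and cyclic words

at : List Bool → ℕ → Bool
at []      _       = false
at (x ∷ l) zero    = x
at (x ∷ l) (suc i) = at l i

at-++ˡ : ∀ l r {i} → i < length l → at (l ++ r) i ≡ at l i
at-++ˡ (x ∷ l) r {zero}  _         = refl
at-++ˡ (x ∷ l) r {suc i} (s≤s i<l) = at-++ˡ l r i<l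

at-++ʳ : ∀ l r i → at (l ++ r) (length l + i) ≡ at r i
at-++ʳ []      r i = refl
at-++ʳ (x ∷ l) r i = at-++ʳ l r i

at-take : ∀ p l {i} → i < p → at (take p l) i ≡ at l i
at-take (suc p) []      _         = refl
at-take (suc p) (x ∷ l) {zero}  _ = refl
at-take (suc p) (x ∷ l) {suc i} (s≤s i<p) = at-take p l i<p

at-reverse : ∀ l {i} → i < length l → at (reverse l) i ≡ at l (length l ∸ suc i)
at-reverse (x ∷ l) {i} i<1+l rewrite unfold-reverse x l with m≤n⇒m<n∨m≡n (s≤s⁻¹ i<1+l)
... | inj₁ i<l  = trans (at-++ˡ (reverse l) [ x ] (subst (i <_) (sym (length-reverse l)) i<l))
                       (trans (at-reverse l i<l) (at-pred (+-∸-assoc 1 i<l)))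
  where at-pred : ∀ {j k} → j ≡ suc k → at l k ≡ at (x ∷ l) j
        at-pred refl = refl
... | inj₂ refl = begin
  at (reverse l ++ [ x ]) (length l)                 ≡⟨ cong (at (reverse l ++ [ x ])) (trans (+-identityʳ _) (length-reverse l)) ⟨
  at (reverse l ++ [ x ]) (length (reverse l) + 0)   ≡⟨ at-++ʳ (reverse l) [ x ] 0 ⟩
  x                                                  ≡⟨ cong (at (x ∷ l)) (n∸n≡0 (length l)) ⟨
  at (x ∷ l) (length l ∸ length l)                   ∎
  where open ≡-Reasoning

list-ext : ∀ (l l′ : List Bool) → length l ≡ length l′ → (∀ {i} → i < length l → at l i ≡ at l′ i) → l ≡ l′
list-ext []      []        _  _ = refl
list-ext (x ∷ l) (x′ ∷ l′) e  h = cong₂ _∷_ (h z<s) (list-ext l l′ (suc-injective e) (h ∘ s≤s))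

length-concat-replicate : ∀ r (X : List Bool) → length (concat (replicate r X)) ≡ r * length X
length-concat-replicate zero    X = refl
length-concat-replicate (suc r) X = trans (length-++ X) (cong (length X +_) (length-concat-replicate r X))

at-concat-replicate : ∀ r X {q} .{{_ : NonZero q}} → length X ≡ q → ∀ {j} → j < r * q →
                      at (concat (replicate r X)) j ≡ at X (j % q)
at-concat-replicate (suc r) X {q} refl {j} j<q+rq with j <? q
... | yes j<q = trans (at-++ˡ X _ j<q) (cong (at X) (sym (m<n⇒m%n≡m j<q)))
... | no  j≮q = begin
  at (X ++ concat (replicate r X)) j               ≡⟨ cong (at (X ++ _)) (m+[n∸m]≡n q≤j) ⟨
  at (X ++ concat (replicate r X)) (q + (j ∸ q))   ≡⟨ at-++ʳ X _ (j ∸ q) ⟩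
  at (concat (replicate r X)) (j ∸ q)              ≡⟨ at-concat-replicate r X refl (+-cancelˡ-< q _ _ (subst (_< q + r * q) (sym (m+[n∸m]≡n q≤j)) j<q+rq)) ⟩
  at X ((j ∸ q) % q)                               ≡⟨ cong (at X) ([m+n]%n≡m%n (j ∸ q) q) ⟨
  at X ((j ∸ q + q) % q)                           ≡⟨ cong (λ m → at X (m % q)) (m∸n+n≡m q≤j) ⟩
  at X (j % q)                                     ∎
  where
  open ≡-Reasoning
  q≤j = ≮⇒≥ j≮q

-- For n = 0 this is the empty set, so that the predicates on Vec Bool n below need no NonZero n.
cyclic : ℕ → List Bool → ℕ → Bool
cyclic zero        _ _ = false
cyclic n@(suc _)   l i = at l (i % n)

cyclic-% : ∀ n .{{_ : NonZero n}} l i → cyclic n l i ≡ at l (i % n)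
cyclic-% (suc _) l i = refl

cyclic-< : ∀ n .{{_ : NonZero n}} l {i} → i < n → cyclic n l i ≡ at l i
cyclic-< n l {i} i<n = trans (cyclic-% n l i) (cong (at l) (m<n⇒m%n≡m i<n))

cyclic-period : ∀ n l → Period (cyclic n l) n
cyclic-period zero        l i = refl
cyclic-period n@(suc _)   l i = cong (at l) ([m+n]%n≡m%n i n)

cyclic-concat-replicate : ∀ r X {q} .{{_ : NonZero q}} .{{_ : NonZero (r * q)}} → length X ≡ q →
                          cyclic (r * q) (concat (replicate r X)) ≗ cyclic q X
cyclic-concat-replicate r X {q} X≡q i = begin
  cyclic (r * q) (concat (replicate r X)) i ≡⟨ cyclic-% (r * q) _ i ⟩
  at (concat (replicate r X)) (i % (r * q)) ≡⟨ at-concat-replicate r X X≡q (m%n<n i (r * q)) ⟩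
  at X (i % (r * q) % q)                    ≡⟨ cong (at X) (m∣n⇒o%n%m≡o%m q (r * q) i (n∣m*n r)) ⟩
  at X (i % q)                              ≡⟨ cyclic-% q X i ⟨
  cyclic q X i                              ∎
  where open ≡-Reasoning

extend : ∀ {n} → Vec Bool n → ℕ → Bool
extend {n} b = cyclic n (toList b)

extend-period : ∀ {n} (b : Vec Bool n) → Period (extend b) n
extend-period {n} b = cyclic-period n (toList b)

sample : ∀ n → (ℕ → Bool) → Vec Bool n
sample zero    f = []
sample (suc n) f = f 0 ∷ sample n (f ∘ suc)

at-sample : ∀ n f {i} → i < n → at (toList (sample n f)) i ≡ f i
at-sample (suc n) f {zero}  _       = refl
at-sample (suc n) f {suc i} (s≤s i<n) = at-sample n (f ∘ suc) i<n

sample-cong : ∀ n {f g : ℕ → Bool} → (∀ {i} → i < n → f i ≡ g i) → sample n f ≡ sample n g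
sample-cong zero    e = refl
sample-cong (suc n) e = cong₂ _∷_ (e z<s) (sample-cong n (e ∘ s≤s))

sample-at : ∀ {n} (b : Vec Bool n) → sample n (at (toList b)) ≡ b
sample-at []      = refl
sample-at (x ∷ b) = cong (x ∷_) (sample-at b)

sample-extend : ∀ {n} (b : Vec Bool n) → sample n (extend b) ≡ b
sample-extend []          = refl
sample-extend b@(_ ∷ _)   = trans (sample-cong _ (cyclic-< _ (toList b))) (sample-at b)

extend-sample : ∀ n .{{_ : NonZero n}} {f} → Period f n → extend (sample n f) ≗ f
extend-sample n {f} per i =
  trans (cyclic-% n _ i) (trans (at-sample n f (m%n<n i n)) (Period-% per i))

sample-≗-extend : ∀ {n f} (b : Vec Bool n) → (∀ i → f i ≡ extend b i) → sample n f ≡ b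
sample-≗-extend b f≗b = trans (sample-cong _ (λ {i} _ → f≗b i)) (sample-extend b)

-- Connection sets

-- For n-periodic f, this says 0 ∈ Ω = −Ω where Ω = {i mod n ∣ f i ≡ true}.
IsConnectionSet : ℕ → (ℕ → Bool) → Set
IsConnectionSet n f = f 0 ≡ true × (∀ i → i < n → f (n ∸ i) ≡ f i)

IsConnectionSet-resp : ∀ {f g n} → f ≗ g → IsConnectionSet n f → IsConnectionSet n g
IsConnectionSet-resp f≗g (f0 , f-reflect) =
  trans (sym (f≗g 0)) f0 , λ i i<n → trans (sym (f≗g _)) (trans (f-reflect i i<n) (f≗g i))

a+b≤n⇒n∸[a+b]+b≡n∸a : ∀ {n} a b → a + b ≤ n → n ∸ (a + b) + b ≡ n ∸ a
a+b≤n⇒n∸[a+b]+b≡n∸a {n} a b a+b≤n = begin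
  n ∸ (a + b) + b ≡⟨ cong (_+ b) (∸-+-assoc n a b) ⟨
  n ∸ a ∸ b + b   ≡⟨ m∸n+n≡m (subst (_≤ n ∸ a) (m+n∸m≡n a b) (∸-monoˡ-≤ a a+b≤n)) ⟩
  n ∸ a           ∎
  where open ≡-Reasoning

module _ {f : ℕ → Bool} {p n} .{{_ : NonZero p}} .{{_ : NonZero n}}
         (perp : Period f p) (p∣n : p ∣ n) where

  reflect-∣ : ∀ {j} → j ≤ p → f (n ∸ j) ≡ f (p ∸ j)
  reflect-∣ {j} j≤p = reflect p∣n
    where
    reflect : p ∣ n → f (n ∸ j) ≡ f (p ∸ j)
    reflect (divides zero    n≡0) = ⊥-elim (≢-nonZero⁻¹ n n≡0)
    reflect (divides (suc k) n≡)  = trans (cong (λ m → f (m ∸ j)) n≡)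
      (trans (cong f (+-∸-comm (k * p) j≤p)) (Period-* perp k (p ∸ j)))

  IsConnectionSet-↓ : IsConnectionSet n f → IsConnectionSet p f
  IsConnectionSet-↓ (f0 , f-reflect) = f0 , λ i i<p →
    trans (sym (reflect-∣ (<⇒≤ i<p))) (f-reflect i (<-≤-trans i<p (∣⇒≤ p∣n)))

  IsConnectionSet-↑ : IsConnectionSet p f → IsConnectionSet n f
  IsConnectionSet-↑ (f0 , f-reflect) = f0 , λ i i<n → begin
    f (n ∸ i)                    ≡⟨ Period-* perp (i / p) (n ∸ i) ⟨
    f (n ∸ i + i / p * p)        ≡⟨ cong (λ j → f (n ∸ j + i / p * p)) (m≡m%n+[m/n]*n i p) ⟩
    f (n ∸ (i % p + i / p * p) + i / p * p)
      ≡⟨ cong f (a+b≤n⇒n∸[a+b]+b≡n∸a (i % p) _ (subst (_≤ n) (m≡m%n+[m/n]*n i p) (<⇒≤ i<n))) ⟩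
    f (n ∸ i % p)                ≡⟨ reflect-∣ (m%n≤n i p) ⟩
    f (p ∸ i % p)                ≡⟨ f-reflect (i % p) (m%n<n i p) ⟩
    f (i % p)                    ≡⟨ Period-% perp i ⟩
    f i                          ∎
    where open ≡-Reasoning

-- The gcd of a support, and dilations

supportGcd : (ℕ → Bool) → ℕ → ℕ → ℕ
supportGcd f n zero    = n
supportGcd f n (suc k) = if f k then gcd (supportGcd f n k) k else supportGcd f n k

module _ (f : ℕ → Bool) (n : ℕ) where

  supportGcd-∣n : ∀ k → supportGcd f n k ∣ n
  supportGcd-∣n zero = ∣-refl
  supportGcd-∣n (suc k) with f k
  ... | true  = ∣-trans (gcd[m,n]∣m _ k) (supportGcd-∣n k)
  ... | false = supportGcd-∣n k

  supportGcd-∣ : ∀ {i k} → i < k → f i ≡ true → supportGcd f n k ∣ i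
  supportGcd-∣ {i} {suc k} i<1+k fi with m≤n⇒m<n∨m≡n (s≤s⁻¹ i<1+k) | f k in fk
  ... | inj₁ i<k  | true  = ∣-trans (gcd[m,n]∣m _ k) (supportGcd-∣ i<k fi)
  ... | inj₁ i<k  | false = supportGcd-∣ i<k fi
  ... | inj₂ refl | true  = gcd[m,n]∣n (supportGcd f n i) i
  ... | inj₂ refl | false = ⊥-elim (not-¬ fk fi)

  supportGcd-greatest-* : ∀ c {x} k → x ∣ c * n → (∀ {i} → i < k → f i ≡ true → x ∣ c * i) →
                          x ∣ c * supportGcd f n k
  supportGcd-greatest-* c zero    x∣cn _        = x∣cn
  supportGcd-greatest-* c (suc k) x∣cn x∣c*supp with f k in fk
  ... | true  = subst (_ ∣_) (sym (c*gcd[m,n]≡gcd[cm,cn] c _ k))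
                  (gcd-greatest (supportGcd-greatest-* c k x∣cn (x∣c*supp ∘ m<n⇒m<1+n)) (x∣c*supp (n<1+n k) fk))
  ... | false = supportGcd-greatest-* c k x∣cn (x∣c*supp ∘ m<n⇒m<1+n)

  supportGcd-greatest : ∀ {d} k → d ∣ n → (∀ {i} → i < k → f i ≡ true → d ∣ i) → d ∣ supportGcd f n k
  supportGcd-greatest {d} k d∣n d∣supp = subst (d ∣_) (*-identityˡ _)
    (supportGcd-greatest-* 1 k (subst (d ∣_) (sym (*-identityˡ n)) d∣n)
      (λ i<k fi → subst (d ∣_) (sym (*-identityˡ _)) (d∣supp i<k fi)))

supportGcd-cong : ∀ {f g} n k → (∀ {i} → i < k → f i ≡ g i) → supportGcd f n k ≡ supportGcd g n k
supportGcd-cong n zero    _   = refl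
supportGcd-cong n (suc k) f≗g = cong₂ (λ b m → if b then gcd m k else m)
  (f≗g (n<1+n k)) (supportGcd-cong n k (f≗g ∘ m<n⇒m<1+n))

module _ (g : ℕ) .{{_ : NonZero g}} where

  -- The image of a subset of ℤ_k under ℤ_k ↪ ℤ_(k g), x ↦ g x.
  dilate : (ℕ → Bool) → ℕ → Bool
  dilate h i = if does (g ∣? i) then h (i / g) else false

  dilate-* : ∀ h t → dilate h (t * g) ≡ h t
  dilate-* h t with g ∣? t * g
  ... | yes _    = cong h (m*n/n≡m t g)
  ... | no  ¬g∣ = ⊥-elim (¬g∣ (n∣m*n t))

  dilate-∤ : ∀ h {i} → ¬ g ∣ i → dilate h i ≡ false
  dilate-∤ h {i} ¬g∣i with g ∣? i
  ... | yes g∣i = ⊥-elim (¬g∣i g∣i)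
  ... | no  _   = refl

  dilate-cong : ∀ {h h′} → h ≗ h′ → dilate h ≗ dilate h′
  dilate-cong h≗h′ i = cong (λ x → if does (g ∣? i) then x else false) (h≗h′ (i / g))

  dilate-period : ∀ {h k} → Period h k → Period (dilate h) (k * g)
  dilate-period {h} {k} per i = by-cases i (g ∣? i)
    where
    by-cases : ∀ i → Dec (g ∣ i) → dilate h (i + k * g) ≡ dilate h i
    by-cases .(t * g) (yes (divides t refl)) = begin
      dilate h (t * g + k * g) ≡⟨ cong (dilate h) (*-distribʳ-+ g t k) ⟨
      dilate h ((t + k) * g)   ≡⟨ dilate-* h (t + k) ⟩
      h (t + k)                ≡⟨ per t ⟩
      h t                      ≡⟨ dilate-* h t ⟨
      dilate h (t * g)         ∎
      where open ≡-Reasoning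
    by-cases i (no ¬g∣i) = trans (dilate-∤ h (¬g∣i ∘ ∣m+n∣m⇒∣n′)) (sym (dilate-∤ h ¬g∣i))
      where ∣m+n∣m⇒∣n′ : g ∣ i + k * g → g ∣ i
            ∣m+n∣m⇒∣n′ g∣i+kg = ∣m+n∣m⇒∣n (subst (g ∣_) (+-comm i _) g∣i+kg) (n∣m*n k)

  IsConnectionSet-dilate : ∀ {h k} → IsConnectionSet k h → IsConnectionSet (k * g) (dilate h)
  IsConnectionSet-dilate {h} {k} (h0 , h-reflect) = trans (dilate-* h 0) h0 , λ i → by-cases i (g ∣? i)
    where
    by-cases : ∀ i → Dec (g ∣ i) → i < k * g → dilate h (k * g ∸ i) ≡ dilate h i
    by-cases .(t * g) (yes (divides t refl)) t*g<k*g = begin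
      dilate h (k * g ∸ t * g) ≡⟨ cong (dilate h) (*-distribʳ-∸ g k t) ⟨
      dilate h ((k ∸ t) * g)   ≡⟨ dilate-* h (k ∸ t) ⟩
      h (k ∸ t)                ≡⟨ h-reflect t (*-cancelʳ-< g t k t*g<k*g) ⟩
      h t                      ≡⟨ dilate-* h t ⟨
      dilate h (t * g)         ∎
      where open ≡-Reasoning
    by-cases i (no ¬g∣i) i<k*g = trans (dilate-∤ h (¬g∣i ∘ g∣i)) (sym (dilate-∤ h ¬g∣i))
      where g∣i : g ∣ k * g ∸ i → g ∣ i
            g∣i g∣kg∸i = ∣m+n∣m⇒∣n (subst (g ∣_) (sym (m∸n+n≡m (<⇒≤ i<k*g))) (n∣m*n k)) g∣kg∸i

  IsConnectionSet-∘* : ∀ {f k} → IsConnectionSet (k * g) f → IsConnectionSet k (f ∘ (_* g))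
  IsConnectionSet-∘* {f} {k} (f0 , f-reflect) = f0 , λ j j<k →
    trans (cong f (*-distribʳ-∸ g k j)) (f-reflect (j * g) (*-monoˡ-< g j<k))

  Period-∘* : ∀ {f k} → Period f (k * g) → Period (f ∘ (_* g)) k
  Period-∘* {f} {k} per j = trans (cong f (*-distribʳ-+ g j k)) (per (j * g))

  dilate-∘* : ∀ {f n} → (∀ {i} → i < n → f i ≡ true → g ∣ i) → ∀ {i} → i < n → dilate (f ∘ (_* g)) i ≡ f i
  dilate-∘* {f} {n} support {i} i<n = by-cases i (g ∣? i) i<n
    where
    by-cases : ∀ i → Dec (g ∣ i) → i < n → dilate (f ∘ (_* g)) i ≡ f i
    by-cases .(t * g) (yes (divides t refl)) _ = dilate-* (f ∘ (_* g)) t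
    by-cases i (no ¬g∣i) i<n = trans (dilate-∤ (f ∘ (_* g)) ¬g∣i) (sym (¬-not (¬g∣i ∘ support i<n)))

  supportGcd-dilate : ∀ h k → supportGcd (dilate h) (k * g) (k * g) ≡ g * supportGcd h k k
  supportGcd-dilate h k = ∣-antisym
    (supportGcd-greatest-* h k g k (subst (G ∣_) (*-comm k g) (supportGcd-∣n (dilate h) (k * g) (k * g)))
      λ {j} j<k hj → subst (G ∣_) (*-comm j g)
        (supportGcd-∣ (dilate h) (k * g) (*-monoˡ-< g j<k) (trans (dilate-* h j) hj)))
    (supportGcd-greatest (dilate h) (k * g) (k * g)
      (subst (g * G′ ∣_) (*-comm g k) (*-monoʳ-∣ g (supportGcd-∣n h k k)))
      λ {i} → by-cases i (g ∣? i))
    where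
    G  = supportGcd (dilate h) (k * g) (k * g)
    G′ = supportGcd h k k
    by-cases : ∀ i → Dec (g ∣ i) → i < k * g → dilate h i ≡ true → g * G′ ∣ i
    by-cases .(t * g) (yes (divides t refl)) t*g<k*g ht = subst (g * G′ ∣_) (*-comm g t)
      (*-monoʳ-∣ g (supportGcd-∣ h k (*-cancelʳ-< g t k t*g<k*g) (trans (sym (dilate-* h t)) ht)))
    by-cases i (no ¬g∣i) _ dhi = ⊥-elim (not-¬ (dilate-∤ h ¬g∣i) dhi)

-- Two partitions of the connection sets

∣-nonZero : ∀ {d n} .{{_ : NonZero n}} → d ∣ n → NonZero d
∣-nonZero {n = n} (divides q n≡q*d) = m*n≢0⇒n≢0 q {{subst NonZero n≡q*d it}}

isConnectionSet? : ∀ n (b : Vec Bool n) → Dec (IsConnectionSet n (extend b))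
isConnectionSet? n b = (extend b 0 ≟ true) ×-dec all<? n (λ i → extend b (n ∸ i) ≟ extend b i)

isConnectionSet : ∀ n → Vec Bool n → Bool
isConnectionSet n = isYes ∘ isConnectionSet? n

aperiodic? : ∀ n (b : Vec Bool n) → Dec (Aperiodic n (extend b))
aperiodic? zero    b = yes (λ _ ())
aperiodic? (suc n) b = Aperiodic? (extend-period b) (suc n)

isAperiodicConnectionSet? : ∀ n (b : Vec Bool n) → Dec (IsConnectionSet n (extend b) × Aperiodic n (extend b))
isAperiodicConnectionSet? n b = isConnectionSet? n b ×-dec aperiodic? n b

isAperiodicConnectionSet : ∀ n → Vec Bool n → Bool
isAperiodicConnectionSet n = isYes ∘ isAperiodicConnectionSet? n

module _ (n : ℕ) .{{_ : NonZero n}} where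

  minimalPeriodᵛ : Vec Bool n → ℕ
  minimalPeriodᵛ b = proj₁ (minimalPeriod (extend-period b))

  minimalPeriodᵛ-≤ : ∀ b → minimalPeriodᵛ b ≤ n
  minimalPeriodᵛ-≤ b = proj₁ (proj₂ (minimalPeriod (extend-period b)))

  minimalPeriodᵛ-minimal : ∀ b → IsMinimalPeriod (extend b) (minimalPeriodᵛ b)
  minimalPeriodᵛ-minimal b = proj₂ (proj₂ (minimalPeriod (extend-period b)))

  period-class↔ : ∀ d .{{_ : NonZero d}} → d ∣ n →
    Solutions n (λ b → isConnectionSet n b ∧ (minimalPeriodᵛ b ≡ᵇ d)) ↔ Solutions d (isAperiodicConnectionSet d)
  period-class↔ d d∣n = mkSolutions↔ (sample d ∘ extend) (sample n ∘ extend) restrict expand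
    (λ c _ → sample-≗-extend c (extend-expand c))
    (λ b t → let (_ , _ , perd , _) = in-class b t in sample-≗-extend b (extend-sample d perd))
    where
    extend-expand : ∀ c → extend (sample n (extend c)) ≗ extend c
    extend-expand c = extend-sample n (Period-∣ (extend-period c) d∣n)
    in-class : ∀ b → T (isConnectionSet n b ∧ (minimalPeriodᵛ b ≡ᵇ d)) →
               IsConnectionSet n (extend b) × IsMinimalPeriod (extend b) d
    in-class b t with Equivalence.to (∧-≡ᵇ⇔ {m = minimalPeriodᵛ b}) t
    ... | cs , refl = toWitness cs , minimalPeriodᵛ-minimal b
    restrict : ∀ b → T (isConnectionSet n b ∧ (minimalPeriodᵛ b ≡ᵇ d)) →
               T (isAperiodicConnectionSet d (sample d (extend b)))
    restrict b t = let (cs , _ , perd , aper) = in-class b t ; e = extend-sample d perd in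
      fromWitness {a? = isAperiodicConnectionSet? d (sample d (extend b))}
        (IsConnectionSet-resp (sym ∘ e) (IsConnectionSet-↓ perd d∣n cs) , Aperiodic-resp (sym ∘ e) aper)
    expand : ∀ c → T (isAperiodicConnectionSet d c) →
             T (isConnectionSet n (sample n (extend c)) ∧ (minimalPeriodᵛ (sample n (extend c)) ≡ᵇ d))
    expand c t = let (cs , aper) = toWitness t ; e = extend-expand c in
      Equivalence.from ∧-≡ᵇ⇔
        ( fromWitness {a? = isConnectionSet? n _} (IsConnectionSet-resp (sym ∘ e) (IsConnectionSet-↑ (extend-period c) d∣n cs))
        , IsMinimalPeriod-unique (minimalPeriodᵛ-minimal _)
            (>-nonZero⁻¹ d , Period-resp (sym ∘ e) (extend-period c) , Aperiodic-resp (sym ∘ e) aper))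

  count-connectionSets-by-period :
    count n (isConnectionSet n) ≡ ∑∣ n (λ d → count d (isAperiodicConnectionSet d))
  count-connectionSets-by-period = count-by-divisor-label n _ minimalPeriodᵛ _ minimalPeriodᵛ-≤
    (λ b _ → IsMinimalPeriod-∣ (extend-period b) (minimalPeriodᵛ-minimal b))
    (λ d d∣n → ↔⇒count≡ (period-class↔ d {{∣-nonZero d∣n}} d∣n))

-- gcd(n, Ω) is the index of ⟨Ω⟩ in ℤ_n, and subgroupOrder Ω = n / gcd(n, Ω) its order.
subgroupIndex : ∀ {n} → Vec Bool n → ℕ
subgroupIndex {n} b = supportGcd (extend b) n n

subgroupIndex-∣ : ∀ {n} (b : Vec Bool n) → subgroupIndex b ∣ n
subgroupIndex-∣ {n} b = supportGcd-∣n (extend b) n n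

subgroupOrder : ∀ {n} → Vec Bool n → ℕ
subgroupOrder b = quotient (subgroupIndex-∣ b)

isConnectedConnectionSet? : ∀ n (b : Vec Bool n) → Dec (IsConnectionSet n (extend b) × subgroupIndex b ≡ 1)
isConnectedConnectionSet? n b = isConnectionSet? n b ×-dec subgroupIndex b ≟ℕ 1

isConnectedConnectionSet : ∀ n → Vec Bool n → Bool
isConnectedConnectionSet n = isYes ∘ isConnectedConnectionSet? n

module Dilation (d g : ℕ) .{{_ : NonZero d}} .{{_ : NonZero g}} where

  N = d * g
  instance _ = m*n≢0 d g

  contract : Vec Bool N → Vec Bool d
  contract b = sample d (extend b ∘ (_* g))

  blowup : Vec Bool d → Vec Bool N
  blowup c = sample N (dilate g (extend c))

  extend-contract : ∀ b → extend (contract b) ≗ extend b ∘ (_* g)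
  extend-contract b = extend-sample d (Period-∘* g (extend-period b))

  extend-blowup : ∀ c → extend (blowup c) ≗ dilate g (extend c)
  extend-blowup c = extend-sample N (dilate-period g (extend-period c))

  contract-blowup : ∀ c → contract (blowup c) ≡ c
  contract-blowup c = sample-≗-extend c (λ j → trans (extend-blowup c (j * g)) (dilate-* g (extend c) j))

  blowup-contract : ∀ b → subgroupIndex b ≡ g → blowup (contract b) ≡ b
  blowup-contract b index≡g = trans (sample-cong N (λ i<N → trans (dilate-cong g (extend-contract b) _)
                                                                  (dilate-∘* g support i<N)))
                                    (sample-extend b)
    where
    support : ∀ {i} → i < N → extend b i ≡ true → g ∣ i
    support i<N bi = subst (_∣ _) index≡g (supportGcd-∣ (extend b) N i<N bi)

  subgroupIndex-blowup : ∀ c → subgroupIndex (blowup c) ≡ g * subgroupIndex c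
  subgroupIndex-blowup c =
    trans (supportGcd-cong N N (λ {i} _ → extend-blowup c i)) (supportGcd-dilate g (extend c) d)

  subgroupIndex-contract : ∀ b → subgroupIndex b ≡ g → subgroupIndex (contract b) ≡ 1
  subgroupIndex-contract b index≡g = *-cancelˡ-≡ _ 1 g (begin
    g * subgroupIndex (contract b)       ≡⟨ subgroupIndex-blowup (contract b) ⟨
    subgroupIndex (blowup (contract b))  ≡⟨ cong subgroupIndex (blowup-contract b index≡g) ⟩
    subgroupIndex b                      ≡⟨ index≡g ⟩
    g                                    ≡⟨ *-identityʳ g ⟨
    g * 1                                ∎)
    where open ≡-Reasoning

  subgroupOrder≡d⇔subgroupIndex≡g : ∀ b → subgroupOrder b ≡ d ⇔ subgroupIndex b ≡ g
  subgroupOrder≡d⇔subgroupIndex≡g b = mk⇔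
    (λ order≡d → *-cancelˡ-≡ _ g d (sym (trans N≡order*index (cong (_* subgroupIndex b) order≡d))))
    (λ index≡g → *-cancelʳ-≡ (subgroupOrder b) d g (sym (trans N≡order*index (cong (subgroupOrder b *_) index≡g))))
    where N≡order*index = m∣n⇒n≡quotient*m (subgroupIndex-∣ b)

  index-class↔ : Solutions N (λ b → isConnectionSet N b ∧ (subgroupOrder b ≡ᵇ d)) ↔
                 Solutions d (isConnectedConnectionSet d)
  index-class↔ = mkSolutions↔ contract blowup restrict expand (λ c _ → contract-blowup c)
    (λ b t → blowup-contract b (proj₂ (in-class b t)))
    where
    in-class : ∀ b → T (isConnectionSet N b ∧ (subgroupOrder b ≡ᵇ d)) →
               IsConnectionSet N (extend b) × subgroupIndex b ≡ g
    in-class b t = let (cs , order≡d) = Equivalence.to (∧-≡ᵇ⇔ {m = subgroupOrder b}) t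
                   in toWitness cs , Equivalence.to (subgroupOrder≡d⇔subgroupIndex≡g b) order≡d
    restrict : ∀ b → T (isConnectionSet N b ∧ (subgroupOrder b ≡ᵇ d)) → T (isConnectedConnectionSet d (contract b))
    restrict b t = let (cs , index≡g) = in-class b t in
      fromWitness {a? = isConnectedConnectionSet? d (contract b)}
        (IsConnectionSet-resp (sym ∘ extend-contract b) (IsConnectionSet-∘* g cs) , subgroupIndex-contract b index≡g)
    expand : ∀ c → T (isConnectedConnectionSet d c) → T (isConnectionSet N (blowup c) ∧ (subgroupOrder (blowup c) ≡ᵇ d))
    expand c t = let (cs , index≡1) = toWitness t in Equivalence.from (∧-≡ᵇ⇔ {m = subgroupOrder (blowup c)})
      ( fromWitness {a? = isConnectionSet? N (blowup c)}
          (IsConnectionSet-resp (sym ∘ extend-blowup c) (IsConnectionSet-dilate g cs))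
      , Equivalence.from (subgroupOrder≡d⇔subgroupIndex≡g (blowup c))
          (trans (subgroupIndex-blowup c) (trans (cong (g *_) index≡1) (*-identityʳ g))))

module _ (n : ℕ) .{{_ : NonZero n}} where

  count-connectionSets-by-index :
    count n (isConnectionSet n) ≡ ∑∣ n (λ d → count d (isConnectedConnectionSet d))
  count-connectionSets-by-index = count-by-divisor-label n _ subgroupOrder _
    (λ b → ∣⇒≤ (quotient-∣ (subgroupIndex-∣ b))) (λ b _ → quotient-∣ (subgroupIndex-∣ b)) class
    where
    class : ∀ d → d ∣ n →
      count n (λ b → isConnectionSet n b ∧ (subgroupOrder b ≡ᵇ d)) ≡ count d (isConnectedConnectionSet d)
    class d d∣n@(divides g n≡g*d) =
      subst (λ m → count m (λ b → isConnectionSet m b ∧ (subgroupOrder b ≡ᵇ d)) ≡ count d (isConnectedConnectionSet d))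
            (sym (trans n≡g*d (*-comm g d)))
            (↔⇒count≡ (Dilation.index-class↔ d g))
      where instance _ = ∣-nonZero d∣n
                     _ = quotient≢0 d∣n

count-aperiodic≡count-connected : ∀ n →
  count n (isAperiodicConnectionSet n) ≡ count n (isConnectedConnectionSet n)
count-aperiodic≡count-connected = <-rec _ step
  where
  step : ∀ n → (∀ {d} → d < n → count d (isAperiodicConnectionSet d) ≡ count d (isConnectedConnectionSet d)) →
         count n (isAperiodicConnectionSet n) ≡ count n (isConnectedConnectionSet n)
  step zero      _       = refl
  step n@(suc _) smaller = ∑∣-cancel n (λ _ _ → smaller)
    (trans (sym (count-connectionSets-by-period n)) (count-connectionSets-by-index n))

-- Connected circulants

n∣x+y⇒both0∨y≡n∸x : ∀ {n x y} → x < n → y < n → n ∣ x + y → (x ≡ 0 × y ≡ 0) ⊎ y ≡ n ∸ x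
n∣x+y⇒both0∨y≡n∸x {n} {x} {y} x<n y<n (divides zero x+y≡0) = inj₁ (m+n≡0⇒m≡0 x x+y≡0 , m+n≡0⇒n≡0 x x+y≡0)
n∣x+y⇒both0∨y≡n∸x {n} {x} {y} x<n y<n (divides (suc zero) x+y≡n) =
  inj₂ (sym (trans (cong (_∸ x) (trans (sym (+-identityʳ n)) (sym x+y≡n))) (m+n∸m≡n x y)))
n∣x+y⇒both0∨y≡n∸x {n} {x} {y} x<n y<n (divides (suc (suc q)) x+y≡n+n+qn) = ⊥-elim (<-irrefl refl (begin-strict
  x + y           <⟨ +-mono-< x<n y<n ⟩
  n + n           ≤⟨ +-monoʳ-≤ n (m≤m+n n (q * n)) ⟩
  n + (n + q * n) ≡⟨ x+y≡n+n+qn ⟨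
  x + y           ∎))
  where open ≤-Reasoning

at-toList : ∀ {n} (v : Vec Bool n) (x : Fin n) → at (toList v) (toℕ x) ≡ lookup v x
at-toList (b ∷ v) zero    = refl
at-toList (b ∷ v) (suc x) = at-toList v x

∈⇔extend : ∀ {n} {Ω : Subset n} {x : Fin n} → x ∈ Ω ⇔ extend Ω (toℕ x) ≡ true
∈⇔extend {n@(suc _)} {Ω} {x} = mk⇔
  (λ x∈Ω → trans (extend-toℕ x) ([]=⇒lookup x∈Ω))
  (λ Ωx → lookup⇒[]= x Ω (trans (sym (extend-toℕ x)) Ωx))
  where
  extend-toℕ : ∀ x → extend Ω (toℕ x) ≡ lookup Ω x
  extend-toℕ x = trans (cyclic-< n (toList Ω) (toℕ<n x)) (at-toList Ω x)

module _ {n} .{{_ : NonZero n}} (Ω : Subset n) where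

  residue : ℕ → Fin n
  residue r = fromℕ< (m%n<n r n)

  toℕ-residue : ∀ r → toℕ (residue r) ≡ r % n
  toℕ-residue r = toℕ-fromℕ< (m%n<n r n)

  residue-% : ∀ {r r′} → r % n ≡ r′ % n → residue r ≡ residue r′
  residue-% {r} {r′} e = toℕ-injective (trans (toℕ-residue r) (trans e (sym (toℕ-residue r′))))

  residue-toℕ : ∀ x → residue (toℕ x) ≡ x
  residue-toℕ x = toℕ-injective (trans (toℕ-residue _) (m<n⇒m%n≡m (toℕ<n x)))

  GeneratedResidue : ℕ → Set
  GeneratedResidue r = Generated Ω (residue r)

  generated-% : ∀ {r r′} → r % n ≡ r′ % n → GeneratedResidue r → GeneratedResidue r′
  generated-% e = subst (Generated Ω) (residue-% e)

  generated-multiple : ∀ {r} → n ∣ r → GeneratedResidue r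
  generated-multiple {r} n∣r = zero (trans (toℕ-residue r) (n∣m⇒m%n≡0 r n n∣r))

  generated-+ : ∀ {a b} → GeneratedResidue a → GeneratedResidue b → GeneratedResidue (a + b)
  generated-+ {a} {b} ga gb = add ga gb (q , (begin
    toℕ (residue a) + toℕ (residue b)            ≡⟨ cong₂ _+_ (toℕ-residue a) (toℕ-residue b) ⟩
    a % n + b % n                                ≡⟨ m≡m%n+[m/n]*n (a % n + b % n) n ⟩
    (a % n + b % n) % n + q * n                  ≡⟨ cong (_+ q * n) (%-distribˡ-+ a b n) ⟨
    (a + b) % n + q * n                          ≡⟨ cong (_+ q * n) (toℕ-residue (a + b)) ⟨
    toℕ (residue (a + b)) + q * n                ∎))
    where
    open ≡-Reasoning
    q = (a % n + b % n) / n

  generated-* : ∀ {a} t → GeneratedResidue a → GeneratedResidue (t * a)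
  generated-* zero    _  = generated-multiple (n ∣0)
  generated-* (suc t) ga = generated-+ ga (generated-* t ga)

  generated-negation : ∀ {a c} → GeneratedResidue a → n ∣ a + c → GeneratedResidue c
  generated-negation {a} {c} ga n∣a+c = neg ga (m%n≡0⇒n∣m _ n (begin
    (toℕ (residue c) + toℕ (residue a)) % n ≡⟨ cong₂ (λ x y → (x + y) % n) (toℕ-residue c) (toℕ-residue a) ⟩
    (c % n + a % n) % n                     ≡⟨ %-distribˡ-+ c a n ⟨
    (c + a) % n                             ≡⟨ cong (_% n) (+-comm c a) ⟩
    (a + c) % n                             ≡⟨ n∣m⇒m%n≡0 _ n n∣a+c ⟩
    0                                       ∎))
    where open ≡-Reasoning

  generated-∸ : ∀ {a b} → GeneratedResidue a → GeneratedResidue b → b ≤ a → GeneratedResidue (a ∸ b)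
  generated-∸ {a} {b} ga gb b≤a = generated-% a-b (generated-+ ga (generated-negation gb n∣b+c))
    where
    c = n ∸ b % n
    n∣b+c : n ∣ b + c
    n∣b+c = divides (suc (b / n)) (begin
      b + (n ∸ b % n)                   ≡⟨ cong (_+ (n ∸ b % n)) (trans (m≡m%n+[m/n]*n b n) (+-comm (b % n) _)) ⟩
      b / n * n + b % n + (n ∸ b % n)   ≡⟨ +-assoc (b / n * n) _ _ ⟩
      b / n * n + (b % n + (n ∸ b % n)) ≡⟨ cong (b / n * n +_) (m+[n∸m]≡n (m%n≤n b n)) ⟩
      b / n * n + n                     ≡⟨ +-comm (b / n * n) n ⟩
      suc (b / n) * n                   ∎)
      where open ≡-Reasoning
    a-b : (a + c) % n ≡ (a ∸ b) % n
    a-b = trans (cong (λ x → (x + c) % n) (sym (m∸n+n≡m b≤a)))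
                (trans (cong (_% n) (+-assoc (a ∸ b) b c)) (%-remove-+ʳ (a ∸ b) n∣b+c))

  generated-member : ∀ {i} → i < n → extend Ω i ≡ true → GeneratedResidue i
  generated-member {i} i<n Ωi = gen (Equivalence.from ∈⇔extend
    (trans (cong (extend Ω) (trans (toℕ-residue i) (m<n⇒m%n≡m i<n))) Ωi))

  generated-summand : ∀ {u v w} → w + v ≡ u → GeneratedResidue u → GeneratedResidue v → GeneratedResidue w
  generated-summand {u} {v} {w} w+v≡u gu gv = subst GeneratedResidue (trans (cong (_∸ v) (sym w+v≡u)) (m+n∸n≡m w v))
    (generated-∸ gu gv (subst (v ≤_) w+v≡u (m≤n+m v w)))

  generated-gcd : ∀ {a b} → GeneratedResidue a → GeneratedResidue b → GeneratedResidue (gcd a b)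
  generated-gcd {a} {b} ga gb with Bézout.identity (gcd-GCD a b)
  ... | Bézout.+- x y eq = generated-summand eq (generated-* x ga) (generated-* y gb)
  ... | Bézout.-+ x y eq = generated-summand eq (generated-* y gb) (generated-* x ga)

  generated-supportGcd : ∀ {k} → k ≤ n → GeneratedResidue (supportGcd (extend Ω) n k)
  generated-supportGcd {zero}  _   = generated-multiple ∣-refl
  generated-supportGcd {suc k} k<n with extend Ω k in Ωk
  ... | true  = generated-gcd (generated-supportGcd (<⇒≤ k<n)) (generated-member k<n Ωk)
  ... | false = generated-supportGcd (<⇒≤ k<n)

  generated-all : subgroupIndex Ω ≡ 1 → ∀ x → Generated Ω x
  generated-all index≡1 x = subst (Generated Ω) (residue-toℕ x)
    (subst GeneratedResidue (*-identityʳ (toℕ x))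
      (generated-* (toℕ x) (subst GeneratedResidue index≡1 (generated-supportGcd ≤-refl))))

  subgroupIndex-∣-generated : ∀ {x} → Generated Ω x → subgroupIndex Ω ∣ toℕ x
  subgroupIndex-∣-generated (gen x∈Ω) = supportGcd-∣ (extend Ω) n (toℕ<n _) (Equivalence.to ∈⇔extend x∈Ω)
  subgroupIndex-∣-generated (zero x≡0) = subst (subgroupIndex Ω ∣_) (sym x≡0) (subgroupIndex Ω ∣0)
  subgroupIndex-∣-generated {x} (add {y = y} {z} gy gz (k , y+z≡x+kn)) = ∣m+n∣m⇒∣n
    (subst (subgroupIndex Ω ∣_) (trans y+z≡x+kn (+-comm (toℕ x) (k * n)))
      (∣m∣n⇒∣m+n (subgroupIndex-∣-generated gy) (subgroupIndex-∣-generated gz)))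
    (∣n⇒∣m*n k (subgroupIndex-∣ Ω))
  subgroupIndex-∣-generated {x} (neg {y = y} gy n∣x+y) = ∣m+n∣m⇒∣n
    (subst (subgroupIndex Ω ∣_) (+-comm (toℕ x) (toℕ y)) (∣-trans (subgroupIndex-∣ Ω) n∣x+y))
    (subgroupIndex-∣-generated gy)

  residue-∈⇔ : ∀ {i} → residue i ∈ Ω ⇔ extend Ω i ≡ true
  residue-∈⇔ {i} = mk⇔
    (λ x∈Ω → trans (sym (extend-residue i)) (Equivalence.to ∈⇔extend x∈Ω))
    (λ Ωi → Equivalence.from ∈⇔extend (trans (extend-residue i) Ωi))
    where
    extend-residue : ∀ i → extend Ω (toℕ (residue i)) ≡ extend Ω i
    extend-residue i = trans (cong (extend Ω) (toℕ-residue i)) (Period-% (extend-period Ω) i)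

  n∣residue+residue-negation : ∀ {i} → i ≤ n → n ∣ toℕ (residue i) + toℕ (residue (n ∸ i))
  n∣residue+residue-negation {i} i≤n = m%n≡0⇒n∣m _ n (begin
    (toℕ (residue i) + toℕ (residue (n ∸ i))) % n ≡⟨ cong₂ (λ a b → (a + b) % n) (toℕ-residue i) (toℕ-residue (n ∸ i)) ⟩
    (i % n + (n ∸ i) % n) % n                     ≡⟨ %-distribˡ-+ i (n ∸ i) n ⟨
    (i + (n ∸ i)) % n                             ≡⟨ cong (_% n) (m+[n∸m]≡n i≤n) ⟩
    n % n                                         ≡⟨ n%n≡0 n ⟩
    0                                             ∎)
    where open ≡-Reasoning

  contains-zero⇔ : (∀ (z : Fin n) → toℕ z ≡ 0 → z ∈ Ω) ⇔ extend Ω 0 ≡ true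
  contains-zero⇔ = mk⇔
    (λ h → Equivalence.to residue-∈⇔ (h (residue 0) (trans (toℕ-residue 0) (m<n⇒m%n≡m (>-nonZero⁻¹ n)))))
    (λ Ω0 z z≡0 → subst (_∈ Ω) (trans (cong residue (sym z≡0)) (residue-toℕ z)) (Equivalence.from residue-∈⇔ Ω0))

  closed-under-negation⇔ :
    (∀ (x y : Fin n) → n ∣ toℕ x + toℕ y → x ∈ Ω → y ∈ Ω) ⇔ (∀ i → i < n → extend Ω (n ∸ i) ≡ extend Ω i)
  closed-under-negation⇔ = mk⇔ reflect closed
    where
    reflect : (∀ (x y : Fin n) → n ∣ toℕ x + toℕ y → x ∈ Ω → y ∈ Ω) → ∀ i → i < n → extend Ω (n ∸ i) ≡ extend Ω i
    reflect closure i i<n = ⇔→≡ (mk⇔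
      (λ Ω-i → Equivalence.to residue-∈⇔ (closure _ _ n∣-i+i (Equivalence.from residue-∈⇔ Ω-i)))
      (λ Ωi → Equivalence.to residue-∈⇔ (closure _ _ n∣i-i (Equivalence.from residue-∈⇔ Ωi))))
      where
      n∣i-i = n∣residue+residue-negation (<⇒≤ i<n)
      n∣-i+i = subst (n ∣_) (+-comm (toℕ (residue i)) _) n∣i-i
    closed : (∀ i → i < n → extend Ω (n ∸ i) ≡ extend Ω i) → ∀ (x y : Fin n) → n ∣ toℕ x + toℕ y → x ∈ Ω → y ∈ Ω
    closed Ω-reflect x y n∣x+y x∈Ω with n∣x+y⇒both0∨y≡n∸x (toℕ<n x) (toℕ<n y) n∣x+y
    ... | inj₁ (x≡0 , y≡0) = subst (_∈ Ω) (toℕ-injective (trans x≡0 (sym y≡0))) x∈Ω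
    ... | inj₂ y≡n∸x       = Equivalence.from ∈⇔extend
      (trans (cong (extend Ω) y≡n∸x) (trans (Ω-reflect (toℕ x) (toℕ<n x)) (Equivalence.to ∈⇔extend x∈Ω)))

IsConnectedCirculant⇔ : ∀ {n} .{{_ : NonZero n}} → 1 < n → (Ω : Subset n) →
  IsConnectedCirculant n Ω ⇔ (IsConnectionSet n (extend Ω) × subgroupIndex Ω ≡ 1)
IsConnectedCirculant⇔ {n} 1<n Ω = mk⇔
  (λ (has-zero , closed , generated) →
    ( Equivalence.to (contains-zero⇔ Ω) has-zero , Equivalence.to (closed-under-negation⇔ Ω) closed)
    , ∣1⇒≡1 (subst (subgroupIndex Ω ∣_) (trans (toℕ-residue Ω 1) (m<n⇒m%n≡m 1<n))
                   (subgroupIndex-∣-generated Ω (generated (residue Ω 1)))))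
  (λ ((Ω0 , Ω-reflect) , index≡1) →
    Equivalence.from (contains-zero⇔ Ω) Ω0 , Equivalence.from (closed-under-negation⇔ Ω) Ω-reflect ,
    generated-all Ω index≡1)

-- Compositions as words

Positive : List ℕ → Set
Positive = All (λ x → 1 ≤ x)

All-reverse : ∀ {w} → Positive w → Positive (reverse w)
All-reverse {[]}    []         = []
All-reverse {a ∷ w} (pa ∷ pw) = subst Positive (sym (unfold-reverse a w)) (∷ʳ⁺ (All-reverse pw) pa)

All-concat-replicate : ∀ r {u} → Positive u → Positive (concat (replicate r u))
All-concat-replicate r pu = concat⁺ (replicate⁺ r pu)

block : ℕ → List Bool
block a = true ∷ replicate (a ∸ 1) false

-- The set of partial sums {0, a₁, a₁ + a₂, …} of a composition.
word : List ℕ → List Bool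
word []      = []
word (a ∷ w) = block a ++ word w

word-++ : ∀ u v → word (u ++ v) ≡ word u ++ word v
word-++ []      v = refl
word-++ (a ∷ u) v = trans (cong (block a ++_) (word-++ u v)) (sym (++-assoc (block a) (word u) (word v)))

word-concat-replicate : ∀ r u → word (concat (replicate r u)) ≡ concat (replicate r (word u))
word-concat-replicate zero    u = refl
word-concat-replicate (suc r) u = trans (word-++ u _) (cong (word u ++_) (word-concat-replicate r u))

length-word : ∀ {w} → Positive w → length (word w) ≡ sum w
length-word {[]}        []        = refl
length-word {suc a ∷ w} (_ ∷ pw) =
  cong suc (trans (length-++ (replicate a false)) (cong₂ _+_ (length-replicate a) (length-word pw)))

-- Also returns the number of leading falses, which belong to no part.
parse : List Bool → ℕ × List ℕ
parse []          = 0 , []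
parse (false ∷ l) = let (k , w) = parse l in suc k , w
parse (true  ∷ l) = let (k , w) = parse l in 0 , suc k ∷ w

parts : List Bool → List ℕ
parts = proj₂ ∘ parse

parse-inverse : ∀ l → replicate (proj₁ (parse l)) false ++ word (parts l) ≡ l
parse-inverse []          = refl
parse-inverse (false ∷ l) = cong (false ∷_) (parse-inverse l)
parse-inverse (true  ∷ l) = cong (true ∷_) (parse-inverse l)

word-parts : ∀ l → word (parts (true ∷ l)) ≡ true ∷ l
word-parts l = parse-inverse (true ∷ l)

parts-positive : ∀ l → Positive (parts l)
parts-positive []          = []
parts-positive (false ∷ l) = parts-positive l
parts-positive (true  ∷ l) = s≤s z≤n ∷ parts-positive l

parse-replicate : ∀ m l → parse (replicate m false ++ l) ≡ (m + proj₁ (parse l) , parts l)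
parse-replicate zero    l = refl
parse-replicate (suc m) l = cong (λ (k , w) → suc k , w) (parse-replicate m l)

parse-word : ∀ {w} → Positive w → parse (word w) ≡ (0 , w)
parse-word {[]}        []        = refl
parse-word {suc a ∷ w} (_ ∷ pw) rewrite parse-replicate a (word w) | parse-word pw | +-identityʳ a = refl

parts-word : ∀ {w} → Positive w → parts (word w) ≡ w
parts-word pw = cong proj₂ (parse-word pw)

word-injective : ∀ {u v} → Positive u → Positive v → word u ≡ word v → u ≡ v
word-injective {u} {v} pu pv e = trans (sym (parts-word pu)) (trans (cong parts e) (parts-word pv))

replicate-∷ʳ : ∀ m (x : Bool) → replicate m x ∷ʳ x ≡ x ∷ replicate m x
replicate-∷ʳ zero    x = refl
replicate-∷ʳ (suc m) x = cong (x ∷_) (replicate-∷ʳ m x)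

reverse-replicate : ∀ m (x : Bool) → reverse (replicate m x) ≡ replicate m x
reverse-replicate zero    x = refl
reverse-replicate (suc m) x =
  trans (unfold-reverse x (replicate m x)) (trans (cong (_∷ʳ x) (reverse-replicate m x)) (replicate-∷ʳ m x))

-- The partial sums of reverse w are the negatives mod n of those of w.
word-reverse : ∀ w → word (reverse w) ∷ʳ true ≡ true ∷ reverse (word w)
word-reverse []      = refl
word-reverse (a ∷ w) = begin
  word (reverse (a ∷ w)) ∷ʳ true                ≡⟨ cong (λ v → word v ∷ʳ true) (unfold-reverse a w) ⟩
  word (reverse w ∷ʳ a) ∷ʳ true                 ≡⟨ cong (_∷ʳ true) (word-++ (reverse w) [ a ]) ⟩
  (word (reverse w) ++ (block a ++ [])) ∷ʳ true ≡⟨ cong (λ v → (word (reverse w) ++ v) ∷ʳ true) (++-identityʳ (block a)) ⟩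
  (word (reverse w) ++ block a) ∷ʳ true         ≡⟨ ++-assoc (word (reverse w)) (block a) [ true ] ⟩
  word (reverse w) ++ (true ∷ zeros ∷ʳ true)    ≡⟨ ++-assoc (word (reverse w)) [ true ] (zeros ∷ʳ true) ⟨
  (word (reverse w) ∷ʳ true) ++ (zeros ∷ʳ true) ≡⟨ cong (_++ (zeros ∷ʳ true)) (word-reverse w) ⟩
  true ∷ reverse (word w) ++ (zeros ∷ʳ true)    ≡⟨ cong (λ v → true ∷ reverse (word w) ++ v) reverse-block ⟨
  true ∷ reverse (word w) ++ reverse (block a)  ≡⟨ cong (true ∷_) (reverse-++ (block a) (word w)) ⟨
  true ∷ reverse (word (a ∷ w))                 ∎
  where
  open ≡-Reasoning
  zeros = replicate (a ∸ 1) false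
  reverse-block : reverse (block a) ≡ zeros ∷ʳ true
  reverse-block = trans (unfold-reverse true zeros) (cong (_∷ʳ true) (reverse-replicate (a ∸ 1) false))

palindrome⇔ : ∀ {w} → Positive w → IsPalindrome w ⇔ (word w ∷ʳ true ≡ true ∷ reverse (word w))
palindrome⇔ {w} pw = mk⇔
  (λ pal → subst (λ v → word v ∷ʳ true ≡ true ∷ reverse (word w)) pal (word-reverse w))
  (λ e → word-injective (All-reverse pw) pw (∷ʳ-injectiveˡ (word (reverse w)) (word w) (trans (word-reverse w) (sym e))))

module _ {n} .{{_ : NonZero n}} (l : List Bool) (l≡n : length l ≡ n) where

  private
    f = cyclic n l

    at-l : ∀ {i} → i < n → at l i ≡ f i
    at-l i<n = sym (cyclic-< n l i<n)

    <l : ∀ {i} → i < n → i < length l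
    <l = subst (_ <_) (sym l≡n)

  symmetric-word⇔ : (l ∷ʳ true ≡ true ∷ reverse l) ⇔ IsConnectionSet n f
  symmetric-word⇔ = mk⇔ to from
    where
    open ≡-Reasoning
    to : l ∷ʳ true ≡ true ∷ reverse l → IsConnectionSet n f
    to e = trans (sym (at-l 0<n)) (trans (sym (at-++ˡ l [ true ] (<l 0<n))) (cong (λ v → at v 0) e)) , reflect
      where
      0<n = >-nonZero⁻¹ n
      reflect : ∀ i → i < n → f (n ∸ i) ≡ f i
      reflect zero    _   = cyclic-period n l 0
      reflect (suc i) i<n = sym (begin
        f (suc i)                 ≡⟨ at-l i<n ⟨
        at l (suc i)              ≡⟨ at-++ˡ l [ true ] (<l i<n) ⟨
        at (l ∷ʳ true) (suc i)    ≡⟨ cong (λ v → at v (suc i)) e ⟩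
        at (reverse l) i          ≡⟨ at-reverse l (<l (<-trans (n<1+n i) i<n)) ⟩
        at l (length l ∸ suc i)   ≡⟨ cong (λ m → at l (m ∸ suc i)) l≡n ⟩
        at l (n ∸ suc i)          ≡⟨ at-l (∸-monoʳ-< z<s (<⇒≤ i<n)) ⟩
        f (n ∸ suc i)             ∎)
    from : IsConnectionSet n f → l ∷ʳ true ≡ true ∷ reverse l
    from (f0 , reflect) = list-ext (l ∷ʳ true) (true ∷ reverse l)
      (trans (length-++ l) (trans (+-comm (length l) 1) (cong suc (sym (length-reverse l))))) same
      where
      head : at l 0 ≡ true
      head = trans (at-l (>-nonZero⁻¹ n)) f0
      same : ∀ {j} → j < length (l ∷ʳ true) → at (l ∷ʳ true) j ≡ at (true ∷ reverse l) j
      same {zero}  _  = trans (at-++ˡ l [ true ] (<l (>-nonZero⁻¹ n))) head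
      same {suc j} sj<l+1 with m≤n⇒m<n∨m≡n (s≤s⁻¹ (subst (suc j <_) (trans (length-++ l) (+-comm (length l) 1)) sj<l+1))
      ... | inj₁ sj<l = begin
        at (l ∷ʳ true) (suc j)   ≡⟨ at-++ˡ l [ true ] sj<l ⟩
        at l (suc j)             ≡⟨ at-l sj<n ⟩
        f (suc j)                ≡⟨ reflect (suc j) sj<n ⟨
        f (n ∸ suc j)            ≡⟨ at-l (∸-monoʳ-< z<s (<⇒≤ sj<n)) ⟨
        at l (n ∸ suc j)         ≡⟨ cong (λ m → at l (m ∸ suc j)) l≡n ⟨
        at l (length l ∸ suc j)  ≡⟨ at-reverse l (<-trans (n<1+n j) sj<l) ⟨
        at (reverse l) j         ∎
        where sj<n = subst (suc j <_) l≡n sj<l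
      ... | inj₂ sj≡l = begin
        at (l ∷ʳ true) (suc j)             ≡⟨ cong (at (l ∷ʳ true)) (trans sj≡l (sym (+-identityʳ _))) ⟩
        at (l ∷ʳ true) (length l + 0)      ≡⟨ at-++ʳ l [ true ] 0 ⟩
        true                               ≡⟨ head ⟨
        at l 0                             ≡⟨ cong (at l) (trans (cong (_∸ suc j) (sym sj≡l)) (n∸n≡0 (suc j))) ⟨
        at l (length l ∸ suc j)            ≡⟨ at-reverse l (subst (j <_) sj≡l (n<1+n j)) ⟨
        at (reverse l) j                   ∎

periodic-word : ∀ {n p} .{{_ : NonZero n}} .{{_ : NonZero p}} (l : List Bool) → length l ≡ n →
  (p∣n : p ∣ n) → Period (cyclic n l) p → l ≡ concat (replicate (quotient p∣n) (take p l))
periodic-word {n} {p} l l≡n p∣n@(divides r n≡rp) per = list-ext _ _ lengths same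
  where
  p≤n = ∣⇒≤ p∣n
  take-p : length (take p l) ≡ p
  take-p = trans (length-take p l) (m≤n⇒m⊓n≡m (subst (p ≤_) (sym l≡n) p≤n))
  lengths : length l ≡ length (concat (replicate r (take p l)))
  lengths = trans l≡n (trans n≡rp (sym (trans (length-concat-replicate r _) (cong (r *_) take-p))))
  same : ∀ {i} → i < length l → at l i ≡ at (concat (replicate r (take p l))) i
  same {i} i<l = begin
    at l i                                   ≡⟨ cyclic-< n l i<n ⟨
    cyclic n l i                             ≡⟨ Period-% per i ⟨
    cyclic n l (i % p)                       ≡⟨ cyclic-< n l (<-≤-trans (m%n<n i p) p≤n) ⟩
    at l (i % p)                             ≡⟨ at-take p l (m%n<n i p) ⟨
    at (take p l) (i % p)                    ≡⟨ at-concat-replicate r (take p l) take-p (subst (i <_) n≡rp i<n) ⟨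
    at (concat (replicate r (take p l))) i   ∎
    where
    open ≡-Reasoning
    i<n = subst (i <_) l≡n i<l

word-parts-take : ∀ {p} w → 0 < p → 0 < length (word w) → word (parts (take p (word w))) ≡ take p (word w)
word-parts-take (a ∷ w) (s≤s _) _ = word-parts _

module _ {n} .{{_ : NonZero n}} {w} (pw : Positive w) (w≡n : length (word w) ≡ n) where

  aperiodic⇔ : IsAperiodic w ⇔ Aperiodic n (cyclic n (word w))
  aperiodic⇔ = mk⇔ to from
    where
    f = cyclic n (word w)
    to : IsAperiodic w → Aperiodic n f
    to aper {q} 0<q q<n per with minimalPeriod (cyclic-period n (word w))
    ... | p , _ , minimal@(0<p , perp , _) = aper (r , parts X , 2≤r , w≡)
      where
      instance _ = >-nonZero 0<p
      p∣n = IsMinimalPeriod-∣ (cyclic-period n (word w)) minimal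
      r = quotient p∣n
      p<n = ≤-<-trans (IsMinimalPeriod-≤ minimal 0<q per) q<n
      2≤r : 2 ≤ r
      2≤r with r | m∣n⇒n≡quotient*m p∣n
      ... | zero        | n≡0   = ⊥-elim (≢-nonZero⁻¹ n n≡0)
      ... | suc zero    | n≡p+0 = ⊥-elim (<-irrefl (sym (trans n≡p+0 (+-identityʳ p))) p<n)
      ... | suc (suc _) | _     = s≤s (s≤s z≤n)
      X = take p (word w)
      word-parts-X : word (parts X) ≡ X
      word-parts-X = word-parts-take w 0<p (subst (0 <_) (sym w≡n) (>-nonZero⁻¹ n))
      w≡ : w ≡ concat (replicate r (parts X))
      w≡ = word-injective pw (All-concat-replicate r (parts-positive X)) (begin
        word w                                   ≡⟨ periodic-word (word w) w≡n p∣n perp ⟩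
        concat (replicate r X)                   ≡⟨ cong (concat ∘ replicate r) word-parts-X ⟨
        concat (replicate r (word (parts X)))    ≡⟨ word-concat-replicate r (parts X) ⟨
        word (concat (replicate r (parts X)))    ∎)
        where open ≡-Reasoning
    from : Aperiodic n f → IsAperiodic w
    from aper (r , u , 2≤r , w≡u^r) = aper 0<q q<n (Period-resp (sym ∘ f≗) (cyclic-period q X))
      where
      X = word u
      q = length X
      word-w : word w ≡ concat (replicate r X)
      word-w = trans (cong word w≡u^r) (word-concat-replicate r u)
      n≡rq : n ≡ r * q
      n≡rq = trans (sym w≡n) (trans (cong length word-w) (length-concat-replicate r X))
      instance
        _ : NonZero q
        _ = ≢-nonZero λ q≡0 → ≢-nonZero⁻¹ n (trans n≡rq (trans (cong (r *_) q≡0) (*-zeroʳ r)))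
        _ : NonZero (r * q)
        _ = >-nonZero (subst (0 <_) n≡rq (>-nonZero⁻¹ n))
      0<q = >-nonZero⁻¹ q
      q<n : q < n
      q<n = subst (q <_) (sym n≡rq) (subst (_< r * q) (*-identityˡ q) (*-monoˡ-< q 2≤r))
      f≗ : f ≗ cyclic q X
      f≗ i = trans (cong (λ (m , l) → cyclic m l i) (cong₂ _,_ n≡rq word-w)) (cyclic-concat-replicate r X refl i)

aperiodicPalindrome⇔ : ∀ {n} .{{_ : NonZero n}} {w} → Positive w → (v : Vec Bool n) → word w ≡ toList v →
  (IsPalindrome w × IsAperiodic w) ⇔ (IsConnectionSet n (extend v) × Aperiodic n (extend v))
aperiodicPalindrome⇔ {n} {w} pw v w≡v =
  subst (λ l → (IsPalindrome w × IsAperiodic w) ⇔ (IsConnectionSet n (cyclic n l) × Aperiodic n (cyclic n l))) w≡v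
    (⇔-trans (palindrome⇔ pw) (symmetric-word⇔ (word w) len) ×-⇔ aperiodic⇔ pw len)
  where len = trans (cong length w≡v) (length-toList v)

toVec : ∀ {n} (l : List Bool) → .(length l ≡ n) → Vec Bool n
toVec l e = cast e (fromList l)

toVec-cong : ∀ {n l l′} .{e : length l ≡ n} .{e′ : length l′ ≡ n} → l ≡ l′ → toVec l e ≡ toVec l′ e′
toVec-cong refl = refl

toList-toVec : ∀ {n} l .(e : length l ≡ n) → toList (toVec l e) ≡ l
toList-toVec l e = trans (toList-cast e (fromList l)) (toList∘fromList l)

toVec-toList : ∀ {n} (v : Vec Bool n) .(e : length (toList v) ≡ n) → toVec (toList v) e ≡ v
toVec-toList v _ = fromList∘toList v

word-parts-toList : ∀ {n} (v : Vec Bool n) → extend v 0 ≡ true → word (parts (toList v)) ≡ toList v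
word-parts-toList (true ∷ v) _ = word-parts (toList v)

keyInverse : ∀ {A B K : Set} (key : A → K) (to : A → B) (from : B → A) →
  (∀ {x y} → key x ≡ key y → to x ≡ to y) → (∀ b → to (from b) ≡ b) → (∀ a → key (from (to a)) ≡ key a) →
  Inverse (On.setoid {B = A} (setoid K) key) (setoid B)
keyInverse key to from to-cong to-from from-to = record
  { to        = to
  ; from      = from
  ; to-cong   = to-cong
  ; from-cong = cong (key ∘ from)
  ; inverse   = (λ {b} e → trans (to-cong e) (to-from b)) , (λ {a} e → trans (cong (key ∘ from) e) (from-to a))
  }

aperiodicPalindromes↔ : ∀ n .{{_ : NonZero n}} →
  Inverse (AperiodicPalindromeSetoid n) (setoid (Solutions n (isAperiodicConnectionSet n)))
aperiodicPalindromes↔ n = keyInverse proj₁ to from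
  (λ e → Solutions-≡ (toVec-cong (cong word e)))
  (λ (v , t) → Solutions-≡ (trans (toVec-cong (word-parts-toList v (head t))) (toVec-toList v (length-toList v))))
  (λ (w , (pw , w≡n) , _) → trans (cong parts (toList-toVec {n} (word w) (trans (length-word pw) w≡n))) (parts-word pw))
  where
  head : ∀ {v} → T (isAperiodicConnectionSet n v) → extend v 0 ≡ true
  head t = proj₁ (proj₁ (toWitness t))
  to : AperiodicPalindrome n → Solutions n (isAperiodicConnectionSet n)
  to (w , (pw , w≡n) , pal , aper) = toVec (word w) len ,
    fromWitness (Equivalence.to (aperiodicPalindrome⇔ pw _ (sym (toList-toVec (word w) len))) (pal , aper))
    where len = trans (length-word pw) w≡n
  from : Solutions n (isAperiodicConnectionSet n) → AperiodicPalindrome n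
  from (v , t) = parts (toList v) , (positive , sum≡n) ,
    Equivalence.from (aperiodicPalindrome⇔ positive v (word-parts-toList v (head t))) (toWitness t)
    where
    positive = parts-positive (toList v)
    sum≡n = trans (sym (length-word positive)) (trans (cong length (word-parts-toList v (head t))) (length-toList v))

connectedCirculants↔ : ∀ n .{{_ : NonZero n}} → 1 < n →
  Inverse (ConnectedCirculantSetoid n) (setoid (Solutions n (isConnectedConnectionSet n)))
connectedCirculants↔ n 1<n = keyInverse proj₁
  (λ (Ω , connected) → Ω , fromWitness (Equivalence.to (IsConnectedCirculant⇔ 1<n Ω) connected))
  (λ (Ω , t) → Ω , Equivalence.from (IsConnectedCirculant⇔ 1<n Ω) (toWitness t))
  Solutions-≡ (λ _ → Solutions-≡ refl) (λ _ → refl)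

theorem3p5 : (n : ℕ) → 2 ≤ n →
    Bijection (AperiodicPalindromeSetoid n) (ConnectedCirculantSetoid n)
theorem3p5 n@(suc _) 1<n = Inverse⇒Bijection
  (Composition.inverse (aperiodicPalindromes↔ n)
  (Composition.inverse (count≡⇒↔ (count-aperiodic≡count-connected n))
                       (Symmetry.inverse (connectedCirculants↔ n 1<n))))
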